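{- Let $G$ be a signed graph and let $\hat G$ be obtained from $G$ by replacing each edge $e$ by a chain or a sheaf as in the context. Colour each edge $e$ of $G$ by $c_n$ if it is replaced by a chain of length $n$ and by $s_n$ if it is replaced by a sheaf of width $n$. In the colored-graph polynomial $W(G)(t,z_1,z_2)$ set $$x_{c_n}=A^n,\quad y_{c_n}=\frac{X^n-A^n}{d},\qquad x_{s_n}=\frac{Y^n-B^n}{d},\quad y_{s_n}=B^n .$$ Then $Q[\hat G]=W(G)(d,d,d)$. If all lengths and widths are positive this is an identity in $\mathbb{Z}[A,B,d]$ with $X=A+Bd$, $Y=Ad+B$; in general (lengths/widths arbitrary nonzero integers) it holds after the substitution $B=A^{ -1}$, $d=-A^2-A^{ -2}$, $X=-A^{ -3}$, $Y=-A^3$.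
   Context: Graphs are finite and may have loops and multiple edges. A signed graph is a graph with a sign $s(e)\in\{+,-\}$ on each edge. $E_n$ is the edgeless graph on $n$ vertices; $G-e$, $G/e$ denote deletion and contraction. Put $X=A+Bd$, $Y=Ad+B$. The polynomial $Q[G]\in\mathbb{Z}[A,B,d]$ is the well-defined invariant of signed graphs determined by: $Q[E_n]=d^{n-1}$; for a loop $e$: $Q[G]=XQ[G-e]$ if $s(e)=-$, $Q[G]=YQ[G-e]$ if $s(e)=+$; for a non-loop $e$: $Q[G]=AQ[G-e]+BQ[G/e]$ if $s(e)=-$, $Q[G]=BQ[G-e]+AQ[G/e]$ if $s(e)=+$. Replacement: $\hat G$ is obtained by replacing each edge $e$ with ends $u,v$ either by a chain (a path of $k\ge1$ edges from $u$ to $v$ through new vertices) or by a sheaf ($k\ge 1$ parallel edges between $u$ and $v$, loops if $u=v$), all new edges having sign $s(e)$; with $\pm$ identified with $\pm1$, the length of the chain (width of the sheaf) is the sum of signs of its edges. Colored-graph polynomial: for a graph $G$ with edge colouring $c:E(G)\to\Lambda$ and indeterminates $x_\lambda,y_\lambda$ ($\lambda\in\Lambda$), $t,z_1,z_2$, $$W(G)=t^{k(G)-1}\sum_{S\subseteq E(G)}\Big(\prod_{e\in S}x_{c(e)}\Big)\Big(\prod_{e\notin S}y_{c(e)}\Big)z_1^{k\langle S\rangle-k(G)}z_2^{n\langle S\rangle},$$ where $k(G)$, $k\langle S\rangle$ are numbers of components of $G$ and of the spanning subgraph with edge set $S$, and $n\langle S\rangle=|S|-|V(G)|+k\langle S\rangle$.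 -}

module Defs where

open import Level using (Level)
open import Function using (id; _∘_)
open import Algebra.Bundles using (CommutativeRing)
open import Data.Nat as ℕ using (ℕ; zero; suc; _∸_)
open import Data.Integer as ℤ using (ℤ; +_; -[1+_])
open import Data.Fin using (Fin; toℕ)
open import Data.List using (List; []; _∷_; _++_; map; replicate; zip)
open import Data.Product using (_×_; _,_; proj₁; proj₂)
open import Relation.Nullary using (yes; no)

data Sign : Set where
  plus  : Sign
  minus : Sign

signed : Sign → ℕ → ℤ
signed plus  k = + k
signed minus k = ℤ.- (+ k)

-- replacement of an edge: chain k = path of k edges, sheaf k = k parallel
-- edges (k ≥ 1 is imposed in the theorem)
data Repl : Set where
  chain : ℕ → Repl
  sheaf : ℕ → Repl

size : Repl → ℕ
size (chain k) = k
size (sheaf k) = k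

data Colour : Set where
  c : ℤ → Colour
  s : ℤ → Colour

-- colour of an edge of sign σ replaced by r:
-- length/width = sum of the signs of the new edges = σ · (number of edges)
colour : Sign → Repl → Colour
colour σ (chain k) = c (signed σ k)
colour σ (sheaf k) = s (signed σ k)

-- Graphs.
-- A signed graph on vertex set Fin n is a list of edges (u , v , sign);
-- loops (u = v) and multiple edges are allowed.

SignedGraph : ℕ → Set
SignedGraph n = List (Fin n × Fin n × Sign)

-- Raw graphs: vertices labelled by naturals, together with a vertex count.
RawEdge : Set
RawEdge = ℕ × ℕ × Sign

forget : ∀ {n} → SignedGraph n → List RawEdge
forget = map (λ { (u , v , σ) → toℕ u , toℕ v , σ })

-- identify vertex v with vertex u (used for contraction)
relabel : ℕ → ℕ → ℕ → ℕ
relabel v u w with w ℕ.≟ v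
... | yes _ = u
... | no  _ = w

-- Number of connected components of the graph with `nv` vertices and the
-- given edges (endpoints read through the identification map ρ): every
-- non-loop edge merges two distinct components into one, loops do nothing.
kcomp : ℕ → (ℕ → ℕ) → List (ℕ × ℕ) → ℕ
kcomp nv ρ [] = nv
kcomp nv ρ ((u , v) ∷ es) with ρ u ℕ.≟ ρ v
... | yes _ = kcomp nv ρ es
... | no  _ = kcomp (nv ∸ 1) (relabel (ρ v) (ρ u) ∘ ρ) es

-- The replacement Ĝ.
-- Fresh vertices are numbered from n upwards.

-- chain of k edges from u to v through new vertices f, f+1, …, f+k-2
chainE : ℕ → ℕ → ℕ → Sign → ℕ → List RawEdge
chainE u v f σ zero = []
chainE u v f σ (suc zero) = (u , v , σ) ∷ []
chainE u v f σ (suc (suc k)) = (u , f , σ) ∷ chainE f v (suc f) σ (suc k)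

sheafE : ℕ → ℕ → Sign → ℕ → List RawEdge
sheafE u v σ k = replicate k (u , v , σ)

-- input: first fresh vertex, edges with replacement data;
-- output: total number of vertices of Ĝ, edges of Ĝ
hatE : ℕ → List (RawEdge × Repl) → ℕ × List RawEdge
hatE f [] = f , []
hatE f (((u , v , σ) , chain k) ∷ es) =
  let r = hatE (f ℕ.+ (k ∸ 1)) es in proj₁ r , chainE u v f σ k ++ proj₂ r
hatE f (((u , v , σ) , sheaf k) ∷ es) =
  let r = hatE f es in proj₁ r , sheafE u v σ k ++ proj₂ r

-- Ĝ for a signed graph G on Fin n with replacement list ρ (aligned with
-- the edge list of G)
hatGraph : ∀ n → SignedGraph n → List Repl → ℕ × List RawEdge
hatGraph n G ρ = hatE n (zip (forget G) ρ)

colouredGraph : ∀ {n} → SignedGraph n → List Repl → List (ℕ × ℕ × Colour)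
colouredGraph G ρ =
  map (λ { ((u , v , σ) , r) → u , v , colour σ r }) (zip (forget G) ρ)

module Poly {a ℓ : Level} (R : CommutativeRing a ℓ) where
  open CommutativeRing R

  infixr 8 _^_
  _^_ : Carrier → ℕ → Carrier
  x ^ zero  = 1#
  x ^ suc k = x * (x ^ k)

  infixl 6 _−_
  _−_ : Carrier → Carrier → Carrier
  x − y = x + (- y)

  -- integer power of x, where x' is the inverse of x
  zpow : Carrier → Carrier → ℤ → Carrier
  zpow x x' (+ k)      = x ^ k
  zpow x x' -[1+ k ]   = x' ^ suc k

  -- Q, via the deletion/contraction rules, applied to the first edge
  -- of the list. nv = number of vertices, ρ = identification of vertices
  -- produced by earlier contractions.
  Qraw : (A B d : Carrier) → ℕ → (ℕ → ℕ) → List RawEdge → Carrier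
  Qraw A B d nv ρ [] = d ^ (nv ∸ 1)
  Qraw A B d nv ρ ((u , v , σ) ∷ es) with ρ u ℕ.≟ ρ v
  ... | yes _ with σ
  ...   | minus = (A + B * d) * Qraw A B d nv ρ es
  ...   | plus  = (A * d + B) * Qraw A B d nv ρ es
  Qraw A B d nv ρ ((u , v , σ) ∷ es) | no _ with σ
  ...   | minus = A * Qraw A B d nv ρ es
                  + B * Qraw A B d (nv ∸ 1) (relabel (ρ v) (ρ u) ∘ ρ) es
  ...   | plus  = B * Qraw A B d nv ρ es
                  + A * Qraw A B d (nv ∸ 1) (relabel (ρ v) (ρ u) ∘ ρ) es

  Q : (A B d : Carrier) → ℕ × List RawEdge → Carrier
  Q A B d (nv , es) = Qraw A B d nv id es

  Qhat : (A B d : Carrier) → ∀ n → SignedGraph n → List Repl → Carrier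
  Qhat A B d n G ρ = Q A B d (hatGraph n G ρ)

  -- the coloured-graph polynomial W(G)(t, z₁, z₂) with the colour
  -- variables x_λ, y_λ specialised to x λ, y λ.
  module _ {Λ : Set} (x y : Λ → Carrier) (t z₁ z₂ : Carrier)
           (nv : ℕ) (es : List (ℕ × ℕ × Λ)) where

    strip : List (ℕ × ℕ × Λ) → List (ℕ × ℕ)
    strip = map (λ { (u , v , _) → u , v })

    kG : ℕ
    kG = kcomp nv id (strip es)

    -- sum over subsets S of the remaining edges; S = chosen edges so far,
    -- sz = |S|, w = product of weights so far
    Wsum : List (ℕ × ℕ) → ℕ → Carrier → List (ℕ × ℕ × Λ) → Carrier
    Wsum S sz w [] =
      let kS = kcomp nv id S in
      w * (z₁ ^ (kS ∸ kG)) * (z₂ ^ ((sz ℕ.+ kS) ∸ nv))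
    Wsum S sz w ((u , v , λc) ∷ rest) =
      Wsum ((u , v) ∷ S) (suc sz) (w * x λc) rest
      + Wsum S sz (w * y λc) rest

    W : Carrier
    W = (t ^ (kG ∸ 1)) * Wsum [] 0 1# es

  Wcol : {n : ℕ} → (x y : Colour → Carrier) → (t z₁ z₂ : Carrier)
         → SignedGraph n → List Repl → Carrier
  Wcol {n} x y t z₁ z₂ G ρ = W x y t z₁ z₂ n (colouredGraph G ρ)

module Submission where

-- Both sides are values of one deletion–contraction recursion, in which an edge of contraction
-- weight x and deletion weight y contributes x·d + y when it has become a loop. Q[Ĝ] is this
-- recursion on Ĝ with the sign weights (A and B for a positive edge, B and A for a negative one).
-- Unfolding it on G with the colour weights as a sum over the sets S of contracted edges, each S
-- carries d^(k⟨S⟩ − 1) from the vertices left and d^n⟨S⟩ from its edges that became loops, which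
-- is W(G)(d,d,d). Finally, a sheaf of k edges acts on the recursion as a single edge of deletion
-- weight B^k, and a chain of k edges as a single edge of contraction weight A^k, since deleting
-- any of its edges leaves pendant paths whose edges each contribute X; the remaining weight is
-- then forced by d·y + A^k = X^k, resp. d·x + B^k = Y^k. Negative signs only exchange A and B.

open import Defs
open import Algebra.Bundles using (CommutativeRing)
open import Level using (0ℓ)
open import Data.Integer using (ℤ; +_; -[1+_]; 0ℤ)
open import Data.Nat as ℕ using (ℕ; zero; suc; _∸_; _≤_; _<_; z≤n; s≤s)
import Data.Nat.Properties as ℕₚ
open import Data.List using (List; []; _∷_; _++_; [_]; length; filter; map; replicate; zip; upTo)
import Data.List.Properties as Listₚ
open import Data.List.Membership.Propositional using (_∈_)
open import Data.List.Relation.Unary.All as All using (All; []; _∷_)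
import Data.List.Relation.Unary.Any as Any
open import Data.List.Relation.Binary.Permutation.Propositional as ↭ using (_↭_)
import Data.List.Relation.Binary.Permutation.Propositional.Properties as ↭ₚ
import Data.List.Membership.Propositional.Properties as ∈ₚ
import Data.List.Relation.Unary.All.Properties as Allₚ
import Data.Fin.Properties as Finₚ
open import Data.Product using (_×_; _,_; proj₁; proj₂)
open import Data.Sum using (_⊎_; inj₁; inj₂)
open import Data.Empty using (⊥-elim)
open import Function using (_∘_; id)
open import Function.Bundles using (_⇔_; mk⇔; Equivalence)
open import Function.Construct.Symmetry using (⇔-sym)
open import Function.Construct.Composition using (_⇔-∘_)
open import Relation.Binary.Core using (Rel)
open import Relation.Nullary using (Dec; yes; no; ¬_; ¬?)
open import Relation.Unary using (Pred; U)
open import Relation.Binary.PropositionalEquality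
  using (_≡_; _≢_; refl; sym; trans; cong; cong₂; subst; module ≡-Reasoning)

All-zip : ∀ {A B : Set} {p q r} {P : Pred A p} {Q : Pred B q} {R : Pred (A × B) r} {xs ys} →
          All P xs → All Q ys → (∀ {a b} → P a → Q b → R (a , b)) → All R (zip xs ys)
All-zip []       _        _ = []
All-zip (_ ∷ _)  []       _ = []
All-zip (p ∷ ps) (q ∷ qs) f = f p q ∷ All-zip ps qs f

-- Identifying vertices

relabel-view : ∀ p q w → (w ≡ p × relabel p q w ≡ q) ⊎ (w ≢ p × relabel p q w ≡ w)
relabel-view p q w with w ℕ.≟ p
... | yes w≡p = inj₁ (w≡p , refl)
... | no  w≢p = inj₂ (w≢p , refl)

identify : (ℕ → ℕ) → ℕ → ℕ → ℕ → ℕ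
identify ρ u v = relabel (ρ v) (ρ u) ∘ ρ

Same : (ℕ → ℕ) → Rel ℕ 0ℓ
Same ρ a b = ρ a ≡ ρ b

Glue : Rel ℕ 0ℓ → ℕ → ℕ → Rel ℕ 0ℓ
Glue R u v a b = R a b ⊎ (R a u ⊎ R a v) × (R b u ⊎ R b v)

Same-identify⁻ : ∀ ρ u v {a b} → Same (identify ρ u v) a b → Glue (Same ρ) u v a b
Same-identify⁻ ρ u v {a} {b} eq with relabel-view (ρ v) (ρ u) (ρ a) | relabel-view (ρ v) (ρ u) (ρ b)
... | inj₁ (a~v , _)  | inj₁ (b~v , _)  = inj₁ (trans a~v (sym b~v))
... | inj₁ (a~v , ra) | inj₂ (_ , rb)   = inj₂ (inj₂ a~v , inj₁ (sym (trans (sym ra) (trans eq rb))))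
... | inj₂ (_ , ra)   | inj₁ (b~v , rb) = inj₂ (inj₁ (trans (sym ra) (trans eq rb)) , inj₂ b~v)
... | inj₂ (_ , ra)   | inj₂ (_ , rb)   = inj₁ (trans (sym ra) (trans eq rb))

identify-glued : ∀ ρ u v {w} → Same ρ w u ⊎ Same ρ w v → identify ρ u v w ≡ ρ u
identify-glued ρ u v {w} w~ with relabel-view (ρ v) (ρ u) (ρ w) | w~
... | inj₁ (_ , r)   | _          = r
... | inj₂ (_ , r)   | inj₁ w~u   = trans r w~u
... | inj₂ (w≁v , _) | inj₂ w~v   = ⊥-elim (w≁v w~v)

Same-identify⁺ : ∀ ρ u v {a b} → Glue (Same ρ) u v a b → Same (identify ρ u v) a b
Same-identify⁺ ρ u v (inj₁ a~b)        = cong (relabel (ρ v) (ρ u)) a~b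
Same-identify⁺ ρ u v (inj₂ (a~ , b~)) = trans (identify-glued ρ u v a~) (sym (identify-glued ρ u v b~))

record _≐[_]_ (R : Rel ℕ 0ℓ) (P : Pred ℕ 0ℓ) (S : Rel ℕ 0ℓ) : Set where
  constructor agree
  field at : ∀ {a b} → P a → P b → R a b ⇔ S a b

  to : ∀ {a b} → P a → P b → R a b → S a b
  to pa pb = Equivalence.to (at pa pb)

  from : ∀ {a b} → P a → P b → S a b → R a b
  from pa pb = Equivalence.from (at pa pb)

open _≐[_]_ public

≐-refl : ∀ {P R} → R ≐[ P ] R
≐-refl = agree (λ _ _ → mk⇔ id id)

≐-sym : ∀ {P R S} → R ≐[ P ] S → S ≐[ P ] R
≐-sym R≐S = agree (λ pa pb → ⇔-sym (at R≐S pa pb))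

infixr 4 _≐-⟫_
_≐-⟫_ : ∀ {P R S T} → R ≐[ P ] S → S ≐[ P ] T → R ≐[ P ] T
R≐S ≐-⟫ S≐T = agree (λ pa pb → at S≐T pa pb ⇔-∘ at R≐S pa pb)

Same-identify : ∀ {P} ρ u v → Same (identify ρ u v) ≐[ P ] Glue (Same ρ) u v
Same-identify ρ u v = agree λ _ _ → mk⇔ (Same-identify⁻ ρ u v) (Same-identify⁺ ρ u v)

module _ {P : Pred ℕ 0ℓ} {u v : ℕ} (pu : P u) (pv : P v) where

  private
    Glue-map : ∀ {R S} → (∀ {a b} → P a → P b → R a b → S a b) →
               ∀ {a b} → P a → P b → Glue R u v a b → Glue S u v a b
    Glue-map f pa pb (inj₁ r) = inj₁ (f pa pb r)
    Glue-map {R} {S} f pa pb (inj₂ (ra , rb)) = inj₂ (ends pa ra , ends pb rb)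
      where
      ends : ∀ {w} → P w → R w u ⊎ R w v → S w u ⊎ S w v
      ends pw (inj₁ r) = inj₁ (f pw pu r)
      ends pw (inj₂ r) = inj₂ (f pw pv r)

  Glue-resp : ∀ {R S} → R ≐[ P ] S → Glue R u v ≐[ P ] Glue S u v
  Glue-resp R≐S = agree λ pa pb → mk⇔ (Glue-map (to R≐S) pa pb) (Glue-map (from R≐S) pa pb)

  identify-resp : ∀ {ρ σ} → Same ρ ≐[ P ] Same σ → Same (identify ρ u v) ≐[ P ] Same (identify σ u v)
  identify-resp {ρ} {σ} ρ≐σ =
    Same-identify ρ u v ≐-⟫ Glue-resp ρ≐σ ≐-⟫ ≐-sym (Same-identify σ u v)

Glue-comm⁺ : ∀ (R : Rel ℕ 0ℓ) → (∀ {a b} → R a b → R b a) → ∀ u v u′ v′ {a b} →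
             Glue (Glue R u v) u′ v′ a b → Glue (Glue R u′ v′) u v a b
Glue-comm⁺ R R-sym u v u′ v′ = glue
  where
  R′ = Glue R u′ v′
  Near Near′ : ℕ → Set
  Near w = R w u ⊎ R w v
  Near′ w = R w u′ ⊎ R w v′
  lift : ∀ {w} → Near w → R′ w u ⊎ R′ w v
  lift (inj₁ r) = inj₁ (inj₁ r)
  lift (inj₂ r) = inj₂ (inj₁ r)
  bridge : ∀ {w} → Near′ w → Near′ u ⊎ Near′ v → R′ w u ⊎ R′ w v
  bridge n (inj₁ n′) = inj₁ (inj₂ (n , n′))
  bridge n (inj₂ n′) = inj₂ (inj₂ (n , n′))
  flip-near : Near u′ ⊎ Near v′ → Near′ u ⊎ Near′ v
  flip-near (inj₁ (inj₁ r)) = inj₁ (inj₁ (R-sym r))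
  flip-near (inj₁ (inj₂ r)) = inj₂ (inj₁ (R-sym r))
  flip-near (inj₂ (inj₁ r)) = inj₁ (inj₂ (R-sym r))
  flip-near (inj₂ (inj₂ r)) = inj₂ (inj₂ (R-sym r))
  split : ∀ {w} → Glue R u v w u′ ⊎ Glue R u v w v′ → Near′ w ⊎ Near w × (Near u′ ⊎ Near v′)
  split (inj₁ (inj₁ r))       = inj₁ (inj₁ r)
  split (inj₁ (inj₂ (n , m))) = inj₂ (n , inj₁ m)
  split (inj₂ (inj₁ r))       = inj₁ (inj₂ r)
  split (inj₂ (inj₂ (n , m))) = inj₂ (n , inj₂ m)
  glue : ∀ {a b} → Glue (Glue R u v) u′ v′ a b → Glue R′ u v a b
  glue (inj₁ (inj₁ r))        = inj₁ (inj₁ r)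
  glue (inj₁ (inj₂ (na , nb))) = inj₂ (lift na , lift nb)
  glue (inj₂ (ca , cb)) with split ca | split cb
  ... | inj₁ na        | inj₁ nb        = inj₁ (inj₂ (na , nb))
  ... | inj₁ na        | inj₂ (nb , m)  = inj₂ (bridge na (flip-near m) , lift nb)
  ... | inj₂ (na , m)  | inj₁ nb        = inj₂ (lift na , bridge nb (flip-near m))
  ... | inj₂ (na , _)  | inj₂ (nb , _)  = inj₂ (lift na , lift nb)

Glue-comm : ∀ {P} ρ u v u′ v′ → Glue (Glue (Same ρ) u v) u′ v′ ≐[ P ] Glue (Glue (Same ρ) u′ v′) u v
Glue-comm ρ u v u′ v′ =
  agree λ _ _ → mk⇔ (Glue-comm⁺ (Same ρ) sym u v u′ v′) (Glue-comm⁺ (Same ρ) sym u′ v′ u v)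

identify-loop : ∀ {P} ρ u v → Same ρ u v → Same (identify ρ u v) ≐[ P ] Same ρ
identify-loop ρ u v u~v = agree λ _ _ → mk⇔ (collapse ∘ Same-identify⁻ ρ u v) (cong (relabel (ρ v) (ρ u)))
  where
  toU : ∀ {w} → Same ρ w u ⊎ Same ρ w v → Same ρ w u
  toU (inj₁ r) = r
  toU (inj₂ r) = trans r (sym u~v)
  collapse : ∀ {a b} → Glue (Same ρ) u v a b → Same ρ a b
  collapse (inj₁ r)         = r
  collapse (inj₂ (ra , rb)) = trans (toU ra) (sym (toU rb))

-- contracting uv turns the link u′v′ into a loop only if contracting u′v′ turns uv into one
Glue-loop-sym : ∀ ρ u v u′ v′ → ¬ Same ρ u′ v′ →
                Glue (Same ρ) u v u′ v′ → Glue (Same ρ) u′ v′ u v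
Glue-loop-sym ρ u v u′ v′ u′≁v′ (inj₁ r) = ⊥-elim (u′≁v′ r)
Glue-loop-sym ρ u v u′ v′ u′≁v′ (inj₂ (inj₁ a , inj₁ b)) = ⊥-elim (u′≁v′ (trans a (sym b)))
Glue-loop-sym ρ u v u′ v′ u′≁v′ (inj₂ (inj₁ a , inj₂ b)) = inj₂ (inj₁ (sym a) , inj₂ (sym b))
Glue-loop-sym ρ u v u′ v′ u′≁v′ (inj₂ (inj₂ a , inj₁ b)) = inj₂ (inj₂ (sym b) , inj₁ (sym a))
Glue-loop-sym ρ u v u′ v′ u′≁v′ (inj₂ (inj₂ a , inj₂ b)) = ⊥-elim (u′≁v′ (trans a (sym b)))

identify-comm : ∀ ρ u v u′ v′ →
                Same (identify (identify ρ u v) u′ v′) ≐[ U ] Same (identify (identify ρ u′ v′) u v)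
identify-comm ρ u v u′ v′ =
  Same-identify (identify ρ u v) u′ v′ ≐-⟫ Glue-resp _ _ (Same-identify ρ u v) ≐-⟫
  Glue-comm ρ u v u′ v′ ≐-⟫
  Glue-resp _ _ (≐-sym (Same-identify ρ u′ v′)) ≐-⟫ ≐-sym (Same-identify (identify ρ u′ v′) u v)

-- Counting components

kcomp-loop : ∀ nv ρ {u v} es → Same ρ u v → kcomp nv ρ ((u , v) ∷ es) ≡ kcomp nv ρ es
kcomp-loop nv ρ {u} {v} es u~v with ρ u ℕ.≟ ρ v
... | yes _   = refl
... | no u≁v = ⊥-elim (u≁v u~v)

kcomp-link : ∀ nv ρ {u v} es → ¬ Same ρ u v →
             kcomp nv ρ ((u , v) ∷ es) ≡ kcomp (nv ∸ 1) (identify ρ u v) es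
kcomp-link nv ρ {u} {v} es u≁v with ρ u ℕ.≟ ρ v
... | yes u~v = ⊥-elim (u≁v u~v)
... | no _    = refl

kcomp-cong : ∀ es nv {ρ σ} → Same ρ ≐[ U ] Same σ → kcomp nv ρ es ≡ kcomp nv σ es
kcomp-cong [] nv _ = refl
kcomp-cong ((u , v) ∷ es) nv {ρ} {σ} ρ≐σ with ρ u ℕ.≟ ρ v | σ u ℕ.≟ σ v
... | yes _   | yes _   = kcomp-cong es nv ρ≐σ
... | yes u~v | no u≁v  = ⊥-elim (u≁v (to ρ≐σ _ _ u~v))
... | no u≁v  | yes u~v = ⊥-elim (u≁v (from ρ≐σ _ _ u~v))
... | no _    | no _    = kcomp-cong es (nv ∸ 1) (identify-resp _ _ ρ≐σ)

kcomp-swap : ∀ nv ρ e f es → kcomp nv ρ (e ∷ f ∷ es) ≡ kcomp nv ρ (f ∷ e ∷ es)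
kcomp-swap nv ρ (u , v) (u′ , v′) es = cases (ρ u ℕ.≟ ρ v) (ρ u′ ℕ.≟ ρ v′)
  where
  open ≡-Reasoning
  e = (u , v)
  f = (u′ , v′)
  ρ₁ = identify ρ u v
  ρ₂ = identify ρ u′ v′
  Goal = kcomp nv ρ (e ∷ f ∷ es) ≡ kcomp nv ρ (f ∷ e ∷ es)

  links : ¬ Same ρ u v → ¬ Same ρ u′ v′ → Dec (Same ρ₁ u′ v′) → Goal
  links u≁v u′≁v′ (yes loop) = begin
    kcomp nv ρ (e ∷ f ∷ es)   ≡⟨ kcomp-link nv ρ (f ∷ es) u≁v ⟩
    kcomp (nv ∸ 1) ρ₁ (f ∷ es) ≡⟨ kcomp-loop (nv ∸ 1) ρ₁ es loop ⟩
    kcomp (nv ∸ 1) ρ₁ es       ≡⟨ kcomp-cong es (nv ∸ 1) ρ₁≐ρ₂ ⟩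
    kcomp (nv ∸ 1) ρ₂ es       ≡⟨ kcomp-loop (nv ∸ 1) ρ₂ es loop′ ⟨
    kcomp (nv ∸ 1) ρ₂ (e ∷ es) ≡⟨ kcomp-link nv ρ (e ∷ es) u′≁v′ ⟨
    kcomp nv ρ (f ∷ e ∷ es)   ∎
    where
    loop′ : Same ρ₂ u v
    loop′ = Same-identify⁺ ρ u′ v′ (Glue-loop-sym ρ u v u′ v′ u′≁v′ (Same-identify⁻ ρ u v loop))
    ρ₁≐ρ₂ : Same ρ₁ ≐[ U ] Same ρ₂
    ρ₁≐ρ₂ = ≐-sym (identify-loop ρ₁ u′ v′ loop) ≐-⟫ identify-comm ρ u v u′ v′ ≐-⟫
            identify-loop ρ₂ u v loop′
  links u≁v u′≁v′ (no link) = begin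
    kcomp nv ρ (e ∷ f ∷ es)                       ≡⟨ kcomp-link nv ρ (f ∷ es) u≁v ⟩
    kcomp (nv ∸ 1) ρ₁ (f ∷ es)                     ≡⟨ kcomp-link (nv ∸ 1) ρ₁ es link ⟩
    kcomp (nv ∸ 1 ∸ 1) (identify ρ₁ u′ v′) es      ≡⟨ kcomp-cong es _ (identify-comm ρ u v u′ v′) ⟩
    kcomp (nv ∸ 1 ∸ 1) (identify ρ₂ u v) es        ≡⟨ kcomp-link (nv ∸ 1) ρ₂ es link′ ⟨
    kcomp (nv ∸ 1) ρ₂ (e ∷ es)                     ≡⟨ kcomp-link nv ρ (e ∷ es) u′≁v′ ⟨
    kcomp nv ρ (f ∷ e ∷ es)                       ∎
    where
    link′ : ¬ Same ρ₂ u v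
    link′ loop = link (Same-identify⁺ ρ u v (Glue-loop-sym ρ u′ v′ u v u≁v (Same-identify⁻ ρ u′ v′ loop)))

  cases : Dec (Same ρ u v) → Dec (Same ρ u′ v′) → Goal
  cases (yes u~v) (yes u′~v′) = begin
    kcomp nv ρ (e ∷ f ∷ es) ≡⟨ kcomp-loop nv ρ (f ∷ es) u~v ⟩
    kcomp nv ρ (f ∷ es)     ≡⟨ kcomp-loop nv ρ es u′~v′ ⟩
    kcomp nv ρ es           ≡⟨ kcomp-loop nv ρ es u~v ⟨
    kcomp nv ρ (e ∷ es)     ≡⟨ kcomp-loop nv ρ (e ∷ es) u′~v′ ⟨
    kcomp nv ρ (f ∷ e ∷ es) ∎
  cases (yes u~v) (no u′≁v′) = begin
    kcomp nv ρ (e ∷ f ∷ es)   ≡⟨ kcomp-loop nv ρ (f ∷ es) u~v ⟩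
    kcomp nv ρ (f ∷ es)       ≡⟨ kcomp-link nv ρ es u′≁v′ ⟩
    kcomp (nv ∸ 1) ρ₂ es       ≡⟨ kcomp-loop (nv ∸ 1) ρ₂ es (cong (relabel (ρ v′) (ρ u′)) u~v) ⟨
    kcomp (nv ∸ 1) ρ₂ (e ∷ es) ≡⟨ kcomp-link nv ρ (e ∷ es) u′≁v′ ⟨
    kcomp nv ρ (f ∷ e ∷ es)   ∎
  cases (no u≁v) (yes u′~v′) = begin
    kcomp nv ρ (e ∷ f ∷ es)   ≡⟨ kcomp-link nv ρ (f ∷ es) u≁v ⟩
    kcomp (nv ∸ 1) ρ₁ (f ∷ es) ≡⟨ kcomp-loop (nv ∸ 1) ρ₁ es (cong (relabel (ρ v) (ρ u)) u′~v′) ⟩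
    kcomp (nv ∸ 1) ρ₁ es       ≡⟨ kcomp-link nv ρ es u≁v ⟨
    kcomp nv ρ (e ∷ es)       ≡⟨ kcomp-loop nv ρ (e ∷ es) u′~v′ ⟨
    kcomp nv ρ (f ∷ e ∷ es)   ∎
  cases (no u≁v) (no u′≁v′) = links u≁v u′≁v′ (ρ₁ u′ ℕ.≟ ρ₁ v′)

kcomp-∷ : ∀ {xs ys} → (∀ nv ρ → kcomp nv ρ xs ≡ kcomp nv ρ ys) →
          ∀ nv ρ e → kcomp nv ρ (e ∷ xs) ≡ kcomp nv ρ (e ∷ ys)
kcomp-∷ eq nv ρ (u , v) with ρ u ℕ.≟ ρ v
... | yes _ = eq nv ρ
... | no _  = eq (nv ∸ 1) (identify ρ u v)

kcomp-↭ : ∀ {xs ys} → xs ↭ ys → ∀ nv ρ → kcomp nv ρ xs ≡ kcomp nv ρ ys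
kcomp-↭ ↭.refl            nv ρ = refl
kcomp-↭ (↭.prep e p)      nv ρ = kcomp-∷ (kcomp-↭ p) nv ρ e
kcomp-↭ {e ∷ f ∷ xs} (↭.swap e f p) nv ρ =
  trans (kcomp-swap nv ρ e f xs) (kcomp-∷ (λ nv′ ρ′ → kcomp-∷ (kcomp-↭ p) nv′ ρ′ e) nv ρ f)
kcomp-↭ (↭.trans p q)     nv ρ = trans (kcomp-↭ p nv ρ) (kcomp-↭ q nv ρ)

kcomp-≤ : ∀ es nv ρ → kcomp nv ρ es ≤ nv
kcomp-≤ []             nv ρ = ℕₚ.≤-refl
kcomp-≤ ((u , v) ∷ es) nv ρ with ρ u ℕ.≟ ρ v
... | yes _ = kcomp-≤ es nv ρ
... | no _  = ℕₚ.≤-trans (kcomp-≤ es (nv ∸ 1) _) (ℕₚ.m∸n≤m nv 1)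

kcomp-++ : ∀ es fs nv ρ → kcomp nv ρ (es ++ fs) ≤ kcomp nv ρ es
kcomp-++ []             fs nv ρ = kcomp-≤ fs nv ρ
kcomp-++ ((u , v) ∷ es) fs nv ρ with ρ u ℕ.≟ ρ v
... | yes _ = kcomp-++ es fs nv ρ
... | no _  = kcomp-++ es fs (nv ∸ 1) _

kcomp-∷-≤ : ∀ e es nv ρ → kcomp nv ρ (e ∷ es) ≤ kcomp nv ρ es
kcomp-∷-≤ e es nv ρ =
  ℕₚ.≤-trans (ℕₚ.≤-reflexive (kcomp-↭ (↭ₚ.∷↭∷ʳ e es) nv ρ)) (kcomp-++ es [ e ] nv ρ)

-- (m , σ) is what remains of (n , ρ) after contracting the edges S, as far as component counts can tell
Contracts : ℕ → (ℕ → ℕ) → List (ℕ × ℕ) → ℕ → (ℕ → ℕ) → Set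
Contracts n ρ S m σ = ∀ T → kcomp n ρ (T ++ S) ≡ kcomp m σ T

Contracts-∷ : ∀ {n ρ S m σ m′ σ′} e → Contracts n ρ S m σ →
              (∀ T → kcomp m σ (e ∷ T) ≡ kcomp m′ σ′ T) → Contracts n ρ (e ∷ S) m′ σ′
Contracts-∷ {n} {ρ} {S} {m} {σ} {m′} {σ′} e contracts step T = begin
  kcomp n ρ (T ++ e ∷ S)        ≡⟨ cong (kcomp n ρ) (Listₚ.++-assoc T [ e ] S) ⟨
  kcomp n ρ ((T ++ [ e ]) ++ S) ≡⟨ contracts (T ++ [ e ]) ⟩
  kcomp m σ (T ++ [ e ])        ≡⟨ kcomp-↭ (↭.↭-sym (↭ₚ.∷↭∷ʳ e T)) m σ ⟩
  kcomp m σ (e ∷ T)             ≡⟨ step T ⟩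
  kcomp m′ σ′ T                 ∎
  where open ≡-Reasoning

-- nv never drops to 0 along the deletion–contraction recursion, so that every nv ∸ 1 there
-- is an honest predecessor
EnoughVertices : ∀ {W : Set} → ℕ → (ℕ → ℕ) → List (ℕ × ℕ × W) → Set
EnoughVertices nv ρ [] = 1 ≤ nv
EnoughVertices nv ρ ((u , v , _) ∷ es) with ρ u ℕ.≟ ρ v
... | yes _ = EnoughVertices nv ρ es
... | no _  = EnoughVertices nv ρ es × EnoughVertices (nv ∸ 1) (identify ρ u v) es

module _ {W : Set} where

  EnoughVertices-positive : ∀ (es : List (ℕ × ℕ × W)) nv ρ → EnoughVertices nv ρ es → 1 ≤ nv
  EnoughVertices-positive []             nv ρ ok = ok
  EnoughVertices-positive ((u , v , _) ∷ es) nv ρ ok with ρ u ℕ.≟ ρ v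
  ... | yes _ = EnoughVertices-positive es nv ρ ok
  ... | no _  = EnoughVertices-positive es nv ρ (proj₁ ok)

  EnoughVertices-tail : ∀ {nv ρ} e (es : List (ℕ × ℕ × W)) →
                        EnoughVertices nv ρ (e ∷ es) → EnoughVertices nv ρ es
  EnoughVertices-tail {nv} {ρ} (u , v , _) es ok with ρ u ℕ.≟ ρ v
  ... | yes _ = ok
  ... | no _  = proj₁ ok

  EnoughVertices-suc : ∀ (es : List (ℕ × ℕ × W)) nv ρ → EnoughVertices nv ρ es → EnoughVertices (suc nv) ρ es
  EnoughVertices-suc []                 nv ρ ok = ℕₚ.≤-trans ok (ℕₚ.n≤1+n nv)
  EnoughVertices-suc ((u , v , _) ∷ es) nv ρ ok with ρ u ℕ.≟ ρ v
  ... | yes _ = EnoughVertices-suc es nv ρ ok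
  ... | no _  = EnoughVertices-suc es nv ρ (proj₁ ok) , subst-count (EnoughVertices-suc es _ _ (proj₂ ok))
    where
    subst-count : EnoughVertices (suc (nv ∸ 1)) (identify ρ u v) es → EnoughVertices nv (identify ρ u v) es
    subst-count = subst (λ m → EnoughVertices m (identify ρ u v) es)
                        (ℕₚ.m+[n∸m]≡n (EnoughVertices-positive es nv ρ (proj₁ ok)))

  EndsIn : (ℕ → ℕ) → List ℕ → ℕ × ℕ × W → Set
  EndsIn ρ R (u , v , _) = ρ u ∈ R × ρ v ∈ R

  -- contracting a link removes the class of v from R, so R never outgrows the vertex count
  Covers⇒EnoughVertices : ∀ es nv ρ R → 1 ≤ length R → length R ≤ nv → All (EndsIn ρ R) es →
                          EnoughVertices nv ρ es
  Covers⇒EnoughVertices []                 nv ρ R 1≤R R≤nv [] = ℕₚ.≤-trans 1≤R R≤nv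
  Covers⇒EnoughVertices ((u , v , _) ∷ es) nv ρ R 1≤R R≤nv ((u∈R , v∈R) ∷ cover) with ρ u ℕ.≟ ρ v
  ... | yes _  = Covers⇒EnoughVertices es nv ρ R 1≤R R≤nv cover
  ... | no u≁v = Covers⇒EnoughVertices es nv ρ R 1≤R R≤nv cover
               , Covers⇒EnoughVertices es (nv ∸ 1) (identify ρ u v) R′ 1≤R′ R′≤nv∸1
                                       (All.map (λ {e} → moved {e}) cover)
    where
    R′ = filter (λ z → ¬? (z ℕ.≟ ρ v)) R
    keep : ∀ {z} → z ∈ R → z ≢ ρ v → z ∈ R′
    keep = ∈ₚ.∈-filter⁺ (λ z → ¬? (z ℕ.≟ ρ v))
    1≤R′ : 1 ≤ length R′
    1≤R′ = ∈ₚ.∈-length (keep u∈R u≁v)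
    R′<R : length R′ < length R
    R′<R = Listₚ.filter-notAll _ R (Any.map (λ v≡z z≢v → z≢v (sym v≡z)) v∈R)
    R′≤nv∸1 : length R′ ≤ nv ∸ 1
    R′≤nv∸1 = ℕₚ.<⇒≤pred (ℕₚ.<-≤-trans R′<R R≤nv)
    moved-vertex : ∀ {w} → ρ w ∈ R → identify ρ u v w ∈ R′
    moved-vertex {w} w∈R with relabel-view (ρ v) (ρ u) (ρ w)
    ... | inj₁ (_ , r)   = subst (_∈ R′) (sym r) (keep u∈R u≁v)
    ... | inj₂ (w≁v , r) = subst (_∈ R′) (sym r) (keep w∈R w≁v)
    moved : ∀ {e} → EndsIn ρ R e → EndsIn (identify ρ u v) R′ e
    moved {_ , _ , _} (a , b) = moved-vertex a , moved-vertex b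

-- The vertices of Ĝ

module Tracking (n : ℕ) where

  Original : Pred ℕ 0ℓ
  Original w = w < n

  Fresh : ℕ → (ℕ → ℕ) → Set
  Fresh g τ = ∀ w → g ≤ w → ∀ a → τ a ≡ τ w → a ≡ w

  Dangling : (ℕ → ℕ) → ℕ → Set
  Dangling τ h = ∀ a → a < n → τ a ≢ τ h

  -- τ is the state of the recursion on Ĝ, ρ the corresponding state on G
  Matches : ℕ → (ℕ → ℕ) → (ℕ → ℕ) → Set
  Matches g τ ρ = Same τ ≐[ Original ] Same ρ × Fresh g τ

  Fresh-identify : ∀ {g τ p q} → Fresh g τ → p < g → q < g → Fresh g (identify τ p q)
  Fresh-identify {g} {τ} {p} {q} fresh p<g q<g w g≤w a a~w with Same-identify⁻ τ p q a~w
  ... | inj₁ a~w               = fresh w g≤w a a~w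
  ... | inj₂ (_ , inj₁ w~p)    = ⊥-elim (ℕₚ.<⇒≢ (ℕₚ.<-≤-trans p<g g≤w) (fresh w g≤w p (sym w~p)))
  ... | inj₂ (_ , inj₂ w~q)    = ⊥-elim (ℕₚ.<⇒≢ (ℕₚ.<-≤-trans q<g g≤w) (fresh w g≤w q (sym w~q)))

  Fresh-suc : ∀ {g τ} → Fresh g τ → Fresh (suc g) τ
  Fresh-suc {g} fresh w g<w = fresh w (ℕₚ.<⇒≤ g<w)

  Fresh⇒Dangling : ∀ {g τ} → Fresh g τ → n ≤ g → Dangling τ g
  Fresh⇒Dangling fresh n≤g a a<n a~g = ℕₚ.<⇒≢ (ℕₚ.<-≤-trans a<n n≤g) (fresh _ ℕₚ.≤-refl a a~g)

  Fresh⇒≢ : ∀ {g τ h} → Fresh g τ → h < g → τ h ≢ τ g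
  Fresh⇒≢ fresh h<g h~g = ℕₚ.<⇒≢ h<g (fresh _ ℕₚ.≤-refl _ h~g)

  identify-dangling : ∀ {τ p q} → Dangling τ p ⊎ Dangling τ q → Same (identify τ p q) ≐[ Original ] Same τ
  identify-dangling {τ} {p} {q} dangling =
    agree λ a<n b<n → mk⇔ (collapse dangling a<n b<n ∘ Same-identify⁻ τ p q) (cong (relabel (τ q) (τ p)))
    where
    collapse : ∀ {a b} → Dangling τ p ⊎ Dangling τ q → a < n → b < n → Glue (Same τ) p q a b → Same τ a b
    collapse _ _ _ (inj₁ a~b) = a~b
    collapse (inj₁ dp) a<n b<n (inj₂ (a~ , b~)) with a~ | b~
    ... | inj₁ a~p | _        = ⊥-elim (dp _ a<n a~p)
    ... | _        | inj₁ b~p = ⊥-elim (dp _ b<n b~p)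
    ... | inj₂ a~q | inj₂ b~q = trans a~q (sym b~q)
    collapse (inj₂ dq) a<n b<n (inj₂ (a~ , b~)) with a~ | b~
    ... | inj₂ a~q | _        = ⊥-elim (dq _ a<n a~q)
    ... | _        | inj₂ b~q = ⊥-elim (dq _ b<n b~q)
    ... | inj₁ a~p | inj₁ b~p = trans a~p (sym b~p)

  Matches-identify : ∀ {g τ ρ u v} → Matches g τ ρ → u < n → v < n → n ≤ g →
                     Matches g (identify τ u v) (identify ρ u v)
  Matches-identify (τ≐ρ , fresh) u<n v<n n≤g =
    identify-resp u<n v<n τ≐ρ , Fresh-identify fresh (ℕₚ.<-≤-trans u<n n≤g) (ℕₚ.<-≤-trans v<n n≤g)

  Matches-pointwise : ∀ {g τ τ′ ρ} → (∀ w → τ w ≡ τ′ w) → Matches g τ ρ → Matches g τ′ ρ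
  Matches-pointwise {τ = τ} {τ′} τ≗τ′ (τ≐ρ , fresh) =
    (agree (λ _ _ → mk⇔ (λ e → trans (τ≗τ′ _) (trans e (sym (τ≗τ′ _))))
                        (λ e → trans (sym (τ≗τ′ _)) (trans e (τ≗τ′ _)))) ≐-⟫ τ≐ρ)
    , λ w g≤w a a~w → fresh w g≤w a (trans (τ≗τ′ a) (trans a~w (sym (τ≗τ′ w))))

  Matches-absorb : ∀ {g τ ρ h v} → Dangling τ h → v < n → h < g → n ≤ g → Matches g τ ρ →
                   Matches g (identify τ h v) ρ
  Matches-absorb dangling v<n h<g n≤g (τ≐ρ , fresh) =
    (identify-dangling (inj₁ dangling) ≐-⟫ τ≐ρ) , Fresh-identify fresh h<g (ℕₚ.<-≤-trans v<n n≤g)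

  Matches-extend : ∀ {g τ ρ h} → h < g → n ≤ g → Matches g τ ρ → Matches (suc g) (identify τ h g) ρ
  Matches-extend h<g n≤g (τ≐ρ , fresh) =
    (identify-dangling (inj₂ (Fresh⇒Dangling fresh n≤g)) ≐-⟫ τ≐ρ)
    , Fresh-identify (Fresh-suc fresh) (ℕₚ.≤-trans h<g (ℕₚ.n≤1+n _)) ℕₚ.≤-refl

  Dangling-extend : ∀ {g τ h} → Dangling τ h → Fresh g τ → n ≤ g → Dangling (identify τ h g) g
  Dangling-extend {g} {τ} {h} dangling fresh n≤g a a<n a~g with Same-identify⁻ τ h g a~g
  ... | inj₁ a~g            = Fresh⇒Dangling fresh n≤g a a<n a~g
  ... | inj₂ (inj₁ a~h , _) = dangling a a<n a~h
  ... | inj₂ (inj₂ a~g , _) = Fresh⇒Dangling fresh n≤g a a<n a~g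

  identify-attached : ∀ τ {h u} → τ h ≡ τ u → ∀ v w → identify τ u v w ≡ identify τ h v w
  identify-attached τ h~u v w = cong (λ r → relabel (τ v) r (τ w)) (sym h~u)

  attached-extend : ∀ {g τ h u} → τ h ≡ τ u → Fresh g τ → u < n → n ≤ g →
                    identify τ h g g ≡ identify τ h g u
  attached-extend {g} {τ} {h} {u} h~u fresh u<n n≤g
    with relabel-view (τ g) (τ h) (τ g) | relabel-view (τ g) (τ h) (τ u)
  ... | inj₂ (g≁g , _) | _             = ⊥-elim (g≁g refl)
  ... | inj₁ (_ , rg)  | inj₁ (u~g , _) = ⊥-elim (Fresh⇒Dangling fresh n≤g u u<n u~g)
  ... | inj₁ (_ , rg)  | inj₂ (_ , ru)  = trans rg (trans h~u (sym ru))

module _ {a ℓ} (R : CommutativeRing a ℓ) where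
  open CommutativeRing R renaming (refl to ≈-refl; sym to ≈-sym; trans to ≈-trans)
  open Poly R
  open import Algebra.Solver.Ring.NaturalCoefficients.Default commutativeSemiring
    using (solve; _:+_; _:*_; _:=_)
  open import Relation.Binary.Reasoning.Setoid setoid
  open import Algebra.Properties.CommutativeSemigroup *-commutativeSemigroup using (x∙yz≈y∙xz)

  ^-cong : ∀ {p q} k → p ≈ q → p ^ k ≈ q ^ k
  ^-cong zero    _   = ≈-refl
  ^-cong (suc k) p≈q = *-cong p≈q (^-cong k p≈q)

  ^-+ : ∀ p i j → p ^ (i ℕ.+ j) ≈ p ^ i * p ^ j
  ^-+ p zero    j = ≈-sym (*-identityˡ _)
  ^-+ p (suc i) j = ≈-trans (*-congˡ (^-+ p i j)) (≈-sym (*-assoc _ _ _))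

  +⇒≈− : ∀ {p q r} → p + q ≈ r → p ≈ r − q
  +⇒≈− {p} {q} {r} p+q≈r = begin
    p             ≈⟨ +-identityʳ p ⟨
    p + 0#        ≈⟨ +-congˡ (-‿inverseʳ q) ⟨
    p + (q − q)   ≈⟨ +-assoc p q (- q) ⟨
    (p + q) − q   ≈⟨ +-congʳ p+q≈r ⟩
    r − q         ∎

  -- An edge labelled l has contraction weight x l and deletion weight y l, and contributes
  -- x l * d + y l as a loop. Q is the case of the sign weights, W(G)(d,d,d) that of the colour weights.
  module DeletionContraction {W : Set} (x y : W → Carrier) (d : Carrier) where

    mutual
      DelCon : ℕ → (ℕ → ℕ) → List (ℕ × ℕ × W) → Carrier
      DelCon nv ρ []               = d ^ (nv ∸ 1)
      DelCon nv ρ ((u , v , l) ∷ es) = edgeStep (x l) (y l) nv ρ u v es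

      edgeStep : Carrier → Carrier → ℕ → (ℕ → ℕ) → ℕ → ℕ → List (ℕ × ℕ × W) → Carrier
      edgeStep a b nv ρ u v es with ρ u ℕ.≟ ρ v
      ... | yes _ = (a * d + b) * DelCon nv ρ es
      ... | no _  = b * DelCon nv ρ es + a * DelCon (nv ∸ 1) (identify ρ u v) es

    edgeStep-loop : ∀ a b nv ρ {u v} es → Same ρ u v → edgeStep a b nv ρ u v es ≡ (a * d + b) * DelCon nv ρ es
    edgeStep-loop a b nv ρ {u} {v} es u~v with ρ u ℕ.≟ ρ v
    ... | yes _   = refl
    ... | no u≁v = ⊥-elim (u≁v u~v)

    edgeStep-link : ∀ a b nv ρ {u v} es → ¬ Same ρ u v →
                    edgeStep a b nv ρ u v es ≡ b * DelCon nv ρ es + a * DelCon (nv ∸ 1) (identify ρ u v) es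
    edgeStep-link a b nv ρ {u} {v} es u≁v with ρ u ℕ.≟ ρ v
    ... | yes u~v = ⊥-elim (u≁v u~v)
    ... | no _    = refl

    edgeStep-cong : ∀ {a a′ b b′} nv ρ u v es → a ≈ a′ → b ≈ b′ →
                    edgeStep a b nv ρ u v es ≈ edgeStep a′ b′ nv ρ u v es
    edgeStep-cong nv ρ u v es a≈a′ b≈b′ with ρ u ℕ.≟ ρ v
    ... | yes _ = *-congʳ (+-cong (*-congʳ a≈a′) b≈b′)
    ... | no _  = +-cong (*-congʳ b≈b′) (*-congʳ a≈a′)

    edgeStep-prefix : ∀ p q z a b nv ρ u v es →
                      p * (z * DelCon nv ρ es) + q * edgeStep a b nv ρ u v es
                      ≈ edgeStep (q * a) (p * z + q * b) nv ρ u v es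
    edgeStep-prefix p q z a b nv ρ u v es with ρ u ℕ.≟ ρ v
    ... | yes _ = solve 7 (λ p q z a b d D → p :* (z :* D) :+ q :* ((a :* d :+ b) :* D)
                                          := (q :* a :* d :+ (p :* z :+ q :* b)) :* D)
                        ≈-refl p q z a b d (DelCon nv ρ es)
    ... | no _  = solve 7 (λ p q z a b D D′ → p :* (z :* D) :+ q :* (b :* D :+ a :* D′)
                                          := (p :* z :+ q :* b) :* D :+ q :* a :* D′)
                        ≈-refl p q z a b (DelCon nv ρ es) (DelCon (nv ∸ 1) (identify ρ u v) es)

    DelCon-suc : ∀ es nv ρ → EnoughVertices nv ρ es → DelCon (suc nv) ρ es ≈ d * DelCon nv ρ es
    DelCon-suc [] (suc nv) ρ _ = ≈-refl
    DelCon-suc ((u , v , l) ∷ es) nv ρ ok with ρ u ℕ.≟ ρ v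
    ... | yes _ = begin
      (x l * d + y l) * DelCon (suc nv) ρ es   ≈⟨ *-congˡ (DelCon-suc es nv ρ ok) ⟩
      (x l * d + y l) * (d * DelCon nv ρ es)   ≈⟨ x∙yz≈y∙xz _ _ _ ⟩
      d * ((x l * d + y l) * DelCon nv ρ es)   ∎
    ... | no _ = begin
      y l * DelCon (suc nv) ρ es + x l * DelCon nv ρ′ es
        ≈⟨ +-cong (*-congˡ (DelCon-suc es nv ρ (proj₁ ok))) (*-congˡ contracted) ⟩
      y l * (d * DelCon nv ρ es) + x l * (d * DelCon (nv ∸ 1) ρ′ es)
        ≈⟨ solve 5 (λ p q d D D′ → p :* (d :* D) :+ q :* (d :* D′) := d :* (p :* D :+ q :* D′))
                 ≈-refl (y l) (x l) d (DelCon nv ρ es) (DelCon (nv ∸ 1) ρ′ es) ⟩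
      d * (y l * DelCon nv ρ es + x l * DelCon (nv ∸ 1) ρ′ es) ∎
      where
      ρ′ = identify ρ u v
      contracted : DelCon nv ρ′ es ≈ d * DelCon (nv ∸ 1) ρ′ es
      contracted = begin
        DelCon nv ρ′ es
          ≡⟨ cong (λ m → DelCon m ρ′ es) (ℕₚ.m+[n∸m]≡n (EnoughVertices-positive es nv ρ (proj₁ ok))) ⟨
        DelCon (suc (nv ∸ 1)) ρ′ es
          ≈⟨ DelCon-suc es (nv ∸ 1) ρ′ (proj₂ ok) ⟩
        d * DelCon (nv ∸ 1) ρ′ es ∎

  label : ∀ {W : Set} → ℕ × ℕ × W → W
  label = proj₂ ∘ proj₂

  DelCon-cong : ∀ {W : Set} {x y x′ y′ : W → Carrier} d nv ρ (es : List (ℕ × ℕ × W)) →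
                All (λ e → x (label e) ≈ x′ (label e) × y (label e) ≈ y′ (label e)) es →
                DeletionContraction.DelCon x y d nv ρ es ≈ DeletionContraction.DelCon x′ y′ d nv ρ es
  DelCon-cong d nv ρ [] [] = ≈-refl
  DelCon-cong d nv ρ ((u , v , _) ∷ es) ((x≈ , y≈) ∷ eqs) with ρ u ℕ.≟ ρ v
  ... | yes _ = *-cong (+-cong (*-congʳ x≈) y≈) (DelCon-cong d nv ρ es eqs)
  ... | no _  = +-cong (*-cong y≈ (DelCon-cong d nv ρ es eqs)) (*-cong x≈ (DelCon-cong d (nv ∸ 1) _ es eqs))

  -- The subset expansion of W

  module SubsetExpansion {Λ : Set} (x y : Λ → Carrier) (d : Carrier) (n : ℕ) (CL : List (ℕ × ℕ × Λ)) where
    open DeletionContraction x y d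

    ends : List (ℕ × ℕ × Λ) → List (ℕ × ℕ)
    ends = strip x y d d d n CL

    k₀ : ℕ
    k₀ = kG x y d d d n CL

    Σ[_,_,_]_ : List (ℕ × ℕ) → ℕ → Carrier → List (ℕ × ℕ × Λ) → Carrier
    Σ[ S , sz , w ] L = Wsum x y d d d n CL S sz w L

    kcomp-positive : ∀ L m σ → EnoughVertices m σ L → 1 ≤ kcomp m σ (ends L)
    kcomp-positive []                 m σ ok = ok
    kcomp-positive ((u , v , _) ∷ L) m σ ok with σ u ℕ.≟ σ v
    ... | yes _ = kcomp-positive L m σ ok
    ... | no _  = kcomp-positive L (m ∸ 1) (identify σ u v) (proj₂ ok)

    exponent-split : ∀ {k m} → 1 ≤ k → k ≤ m → (k ∸ 1) ℕ.+ (m ∸ k) ≡ m ∸ 1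
    exponent-split {suc k} {suc m} _ (s≤s k≤m) = ℕₚ.m+[n∸m]≡n k≤m

    -- S (of size sz) holds the edges chosen so far and (m , σ) is G with S contracted,
    -- so that i = sz + m − n is the nullity n⟨S⟩
    Wsum≈DelCon : ∀ L S sz w m σ i → 1 ≤ k₀ → EnoughVertices m σ L →
                Contracts n id S m σ → k₀ ≤ kcomp m σ (ends L) →
                sz ℕ.+ m ≡ i ℕ.+ n →
                d ^ (k₀ ∸ 1) * Σ[ S , sz , w ] L ≈ w * d ^ i * DelCon m σ L
    Wsum≈DelCon [] S sz w m σ i 1≤k₀ ok contracted k₀≤m size = begin
      d ^ (k₀ ∸ 1) * (w * d ^ (kS ∸ k₀) * d ^ ((sz ℕ.+ kS) ∸ n))
        ≡⟨ cong (λ k → d ^ (k₀ ∸ 1) * (w * d ^ (k ∸ k₀) * d ^ ((sz ℕ.+ k) ∸ n))) (contracted []) ⟩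
      d ^ (k₀ ∸ 1) * (w * d ^ (m ∸ k₀) * d ^ ((sz ℕ.+ m) ∸ n))
        ≡⟨ cong (λ e → d ^ (k₀ ∸ 1) * (w * d ^ (m ∸ k₀) * d ^ e))
                (trans (cong (_∸ n) size) (ℕₚ.m+n∸n≡m i n)) ⟩
      d ^ (k₀ ∸ 1) * (w * d ^ (m ∸ k₀) * d ^ i)
        ≈⟨ solve 4 (λ P Q w L → P :* (w :* Q :* L) := w :* L :* (P :* Q))
                 ≈-refl (d ^ (k₀ ∸ 1)) (d ^ (m ∸ k₀)) w (d ^ i) ⟩
      w * d ^ i * (d ^ (k₀ ∸ 1) * d ^ (m ∸ k₀))
        ≈⟨ *-congˡ (^-+ d (k₀ ∸ 1) (m ∸ k₀)) ⟨
      w * d ^ i * d ^ ((k₀ ∸ 1) ℕ.+ (m ∸ k₀))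
        ≡⟨ cong (λ e → w * d ^ i * d ^ e) (exponent-split 1≤k₀ k₀≤m) ⟩
      w * d ^ i * d ^ (m ∸ 1) ∎
      where kS = kcomp n id S
    Wsum≈DelCon ((u , v , l) ∷ L) S sz w m σ i 1≤k₀ ok contracted k₀≤k size with σ u ℕ.≟ σ v
    ... | yes u~v = begin
      d ^ (k₀ ∸ 1) * (Σ[ (u , v) ∷ S , suc sz , w * x l ] L + Σ[ S , sz , w * y l ] L)
        ≈⟨ distribˡ _ _ _ ⟩
      d ^ (k₀ ∸ 1) * Σ[ (u , v) ∷ S , suc sz , w * x l ] L + d ^ (k₀ ∸ 1) * Σ[ S , sz , w * y l ] L
        ≈⟨ +-cong (Wsum≈DelCon L ((u , v) ∷ S) (suc sz) (w * x l) m σ (suc i) 1≤k₀ ok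
                     (Contracts-∷ (u , v) contracted (λ T → kcomp-loop m σ T u~v)) k₀≤k (cong suc size))
                  (Wsum≈DelCon L S sz (w * y l) m σ i 1≤k₀ ok contracted k₀≤k size) ⟩
      w * x l * (d * d ^ i) * D + w * y l * d ^ i * D
        ≈⟨ solve 6 (λ w x y d L D → w :* x :* (d :* L) :* D :+ w :* y :* L :* D := w :* L :* ((x :* d :+ y) :* D))
                 ≈-refl w (x l) (y l) d (d ^ i) D ⟩
      w * d ^ i * ((x l * d + y l) * D) ∎
      where D = DelCon m σ L
    ... | no u≁v = begin
      d ^ (k₀ ∸ 1) * (Σ[ (u , v) ∷ S , suc sz , w * x l ] L + Σ[ S , sz , w * y l ] L)
        ≈⟨ distribˡ _ _ _ ⟩
      d ^ (k₀ ∸ 1) * Σ[ (u , v) ∷ S , suc sz , w * x l ] L + d ^ (k₀ ∸ 1) * Σ[ S , sz , w * y l ] L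
        ≈⟨ +-cong (Wsum≈DelCon L ((u , v) ∷ S) (suc sz) (w * x l) (m ∸ 1) σ′ i 1≤k₀ (proj₂ ok)
                     (Contracts-∷ (u , v) contracted (λ T → kcomp-link m σ T u≁v)) k₀≤k size′)
                  (Wsum≈DelCon L S sz (w * y l) m σ i 1≤k₀ (proj₁ ok) contracted k₀≤k′ size) ⟩
      w * x l * d ^ i * D′ + w * y l * d ^ i * D
        ≈⟨ solve 6 (λ w x y L D D′ → w :* x :* L :* D′ :+ w :* y :* L :* D := w :* L :* (y :* D :+ x :* D′))
                 ≈-refl w (x l) (y l) (d ^ i) D D′ ⟩
      w * d ^ i * (y l * D + x l * D′) ∎
      where
      σ′ = identify σ u v
      D = DelCon m σ L
      D′ = DelCon (m ∸ 1) σ′ L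
      size′ : suc sz ℕ.+ (m ∸ 1) ≡ i ℕ.+ n
      size′ = trans (sym (ℕₚ.+-suc sz (m ∸ 1)))
                    (trans (cong (sz ℕ.+_) (ℕₚ.m+[n∸m]≡n (EnoughVertices-positive L m σ (proj₁ ok)))) size)
      k₀≤k′ : k₀ ≤ kcomp m σ (ends L)
      k₀≤k′ = ℕₚ.≤-trans k₀≤k (ℕₚ.≤-trans (ℕₚ.≤-reflexive (sym (kcomp-link m σ (ends L) u≁v)))
                                            (kcomp-∷-≤ (u , v) (ends L) m σ))

    W≈DelCon : EnoughVertices n id CL → W x y d d d n CL ≈ DelCon n id CL
    W≈DelCon ok = begin
      d ^ (k₀ ∸ 1) * Σ[ [] , 0 , 1# ] CL
        ≈⟨ Wsum≈DelCon CL [] 0 1# n id 0 (kcomp-positive CL n id ok) ok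
                     (λ T → cong (kcomp n id) (Listₚ.++-identityʳ T)) ℕₚ.≤-refl refl ⟩
      1# * 1# * DelCon n id CL ≈⟨ *-congʳ (*-identityˡ 1#) ⟩
      1# * DelCon n id CL      ≈⟨ *-identityˡ _ ⟩
      DelCon n id CL           ∎

  -- Chains and sheaves

  module Replacement (A B d : Carrier) where

    α β : Sign → Carrier
    α plus  = A
    α minus = B
    β plus  = B
    β minus = A

    loopFactor pendantFactor : Sign → Carrier
    loopFactor σ    = α σ * d + β σ
    pendantFactor σ = β σ * d + α σ

    -- A chain of k edges acts as one edge of contraction weight α σ ^ k and deletion weight
    -- chainDel σ k, a sheaf as one of contraction weight sheafCon σ k and deletion weight β σ ^ k.
    chainDel sheafCon : Sign → ℕ → Carrier
    chainDel σ zero    = 0#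
    chainDel σ (suc k) = β σ * pendantFactor σ ^ k + α σ * chainDel σ k
    sheafCon σ zero    = 0#
    sheafCon σ (suc k) = β σ * sheafCon σ k + α σ * loopFactor σ ^ k

    chainDel-spec : ∀ σ k → d * chainDel σ k + α σ ^ k ≈ pendantFactor σ ^ k
    chainDel-spec σ zero = ≈-trans (+-congʳ (zeroʳ d)) (+-identityˡ 1#)
    chainDel-spec σ (suc k) = begin
      d * (β σ * P + α σ * chainDel σ k) + α σ * α σ ^ k
        ≈⟨ solve 6 (λ d b a P y A → d :* (b :* P :+ a :* y) :+ a :* A := b :* d :* P :+ a :* (d :* y :+ A))
                 ≈-refl d (β σ) (α σ) P (chainDel σ k) (α σ ^ k) ⟩
      β σ * d * P + α σ * (d * chainDel σ k + α σ ^ k) ≈⟨ +-congˡ (*-congˡ (chainDel-spec σ k)) ⟩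
      β σ * d * P + α σ * P                            ≈⟨ distribʳ P (β σ * d) (α σ) ⟨
      pendantFactor σ * P                              ∎
      where P = pendantFactor σ ^ k

    sheafCon-spec : ∀ σ k → sheafCon σ k * d + β σ ^ k ≈ loopFactor σ ^ k
    sheafCon-spec σ zero = ≈-trans (+-congʳ (zeroˡ d)) (+-identityˡ 1#)
    sheafCon-spec σ (suc k) = begin
      (β σ * sheafCon σ k + α σ * L) * d + β σ * β σ ^ k
        ≈⟨ solve 6 (λ d b a L x B → (b :* x :+ a :* L) :* d :+ b :* B := b :* (x :* d :+ B) :+ a :* d :* L)
                 ≈-refl d (β σ) (α σ) L (sheafCon σ k) (β σ ^ k) ⟩
      β σ * (sheafCon σ k * d + β σ ^ k) + α σ * d * L ≈⟨ +-congʳ (*-congˡ (sheafCon-spec σ k)) ⟩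
      β σ * L + α σ * d * L
        ≈⟨ solve 4 (λ b a d L → b :* L :+ a :* d :* L := (a :* d :+ b) :* L) ≈-refl (β σ) (α σ) d L ⟩
      loopFactor σ * L                                 ∎
      where L = loopFactor σ ^ k

    byInt : (Sign → ℕ → Carrier) → ℤ → Carrier
    byInt w (+ k)    = w plus k
    byInt w -[1+ k ] = w minus (suc k)

    byInt-signed : ∀ w σ k → byInt w (signed σ (suc k)) ≡ w σ (suc k)
    byInt-signed w plus  k = refl
    byInt-signed w minus k = refl

    colourCon colourDel : Colour → Carrier
    colourCon (c m) = byInt (λ σ k → α σ ^ k) m
    colourCon (s m) = byInt sheafCon m
    colourDel (c m) = byInt chainDel m
    colourDel (s m) = byInt (λ σ k → β σ ^ k) m

    module Ĝ = DeletionContraction α β d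
    module G = DeletionContraction colourCon colourDel d

    Q≈DelCon : ∀ nv ρ es → Qraw A B d nv ρ es ≈ Ĝ.DelCon nv ρ es
    Q≈DelCon nv ρ [] = ≈-refl
    Q≈DelCon nv ρ ((u , v , plus) ∷ es) with ρ u ℕ.≟ ρ v
    ... | yes _ = *-congˡ (Q≈DelCon nv ρ es)
    ... | no _  = +-cong (*-congˡ (Q≈DelCon nv ρ es)) (*-congˡ (Q≈DelCon (nv ∸ 1) _ es))
    Q≈DelCon nv ρ ((u , v , minus) ∷ es) with ρ u ℕ.≟ ρ v
    ... | yes _ = *-cong (+-comm A (B * d)) (Q≈DelCon nv ρ es)
    ... | no _  = +-cong (*-congˡ (Q≈DelCon nv ρ es)) (*-congˡ (Q≈DelCon (nv ∸ 1) _ es))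

    module Replacing (n : ℕ) where
      open Tracking n

      -- rest̂ is the part of Ĝ after the block, with spare new vertices from F on, and continue is the
      -- claim for the remaining edges
      module Block (σ : Sign) {u v : ℕ} (u<n : u < n) (v<n : v < n) (ρ : ℕ → ℕ)
                   (rest : List (ℕ × ℕ × Colour)) (rest̂ : List RawEdge) (spare F : ℕ) (n≤F : n ≤ F)
                   (continue : ∀ M τ ρ′ → Matches F τ ρ′ → EnoughVertices M ρ′ rest →
                               Ĝ.DelCon (M ℕ.+ spare) τ rest̂ ≈ G.DelCon M ρ′ rest) where

        X Y : Carrier
        X = pendantFactor σ
        Y = loopFactor σ

        singleEdge : ∀ {h τ M col} → τ h ≡ τ u → Matches F τ ρ → EnoughVertices M ρ ((u , v , col) ∷ rest) →
                     Ĝ.DelCon (M ℕ.+ spare) τ ((h , v , σ) ∷ rest̂) ≈ G.edgeStep (α σ) (β σ) M ρ u v rest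
        singleEdge {h} {τ} {M} h~u (τ≐ρ , fresh) ok with ρ u ℕ.≟ ρ v
        ... | yes u~v = begin
          Ĝ.DelCon (M ℕ.+ spare) τ ((h , v , σ) ∷ rest̂)
            ≡⟨ Ĝ.edgeStep-loop (α σ) (β σ) _ τ rest̂ (trans h~u (from τ≐ρ u<n v<n u~v)) ⟩
          Y * Ĝ.DelCon (M ℕ.+ spare) τ rest̂ ≈⟨ *-congˡ (continue M τ ρ (τ≐ρ , fresh) ok) ⟩
          Y * G.DelCon M ρ rest             ∎
        ... | no u≁v = begin
          Ĝ.DelCon (M ℕ.+ spare) τ ((h , v , σ) ∷ rest̂)
            ≡⟨ Ĝ.edgeStep-link (α σ) (β σ) _ τ rest̂ (λ h~v → u≁v (to τ≐ρ u<n v<n (trans (sym h~u) h~v))) ⟩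
          β σ * Ĝ.DelCon (M ℕ.+ spare) τ rest̂ + α σ * Ĝ.DelCon (M ℕ.+ spare ∸ 1) τ′ rest̂
            ≡⟨ cong (λ m → β σ * Ĝ.DelCon (M ℕ.+ spare) τ rest̂ + α σ * Ĝ.DelCon m τ′ rest̂) count ⟩
          β σ * Ĝ.DelCon (M ℕ.+ spare) τ rest̂ + α σ * Ĝ.DelCon (M ∸ 1 ℕ.+ spare) τ′ rest̂
            ≈⟨ +-cong (*-congˡ (continue M τ ρ (τ≐ρ , fresh) (proj₁ ok)))
                      (*-congˡ (continue (M ∸ 1) τ′ (identify ρ u v) matches (proj₂ ok))) ⟩
          β σ * G.DelCon M ρ rest + α σ * G.DelCon (M ∸ 1) (identify ρ u v) rest ∎
          where
          τ′ = identify τ h v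
          count : M ℕ.+ spare ∸ 1 ≡ M ∸ 1 ℕ.+ spare
          count = ℕₚ.+-∸-comm spare (EnoughVertices-positive rest M ρ (proj₁ ok))
          matches : Matches F τ′ (identify ρ u v)
          matches = Matches-pointwise (identify-attached τ h~u v)
                                      (Matches-identify (τ≐ρ , fresh) u<n v<n n≤F)

        pendantPath : ∀ j {h g τ M} → Dangling τ h → h < g → n ≤ g → Matches g τ ρ → g ℕ.+ j ≡ F →
                      EnoughVertices M ρ rest →
                      Ĝ.DelCon (suc M ℕ.+ j ℕ.+ spare) τ (chainE h v g σ (suc j) ++ rest̂)
                      ≈ X ^ suc j * G.DelCon M ρ rest
        pendantPath zero {h} {g} {τ} {M} dangling h<g n≤g matches g+0≡F ok = begin
          Ĝ.DelCon (suc M ℕ.+ 0 ℕ.+ spare) τ ((h , v , σ) ∷ rest̂)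
            ≡⟨ Ĝ.edgeStep-link (α σ) (β σ) _ τ rest̂ (λ h~v → dangling v v<n (sym h~v)) ⟩
          β σ * Ĝ.DelCon (suc M ℕ.+ 0 ℕ.+ spare) τ rest̂ + α σ * Ĝ.DelCon (M ℕ.+ 0 ℕ.+ spare) τ′ rest̂
            ≡⟨ cong₂ (λ m m′ → β σ * Ĝ.DelCon (m ℕ.+ spare) τ rest̂ + α σ * Ĝ.DelCon (m′ ℕ.+ spare) τ′ rest̂)
                     (ℕₚ.+-identityʳ (suc M)) (ℕₚ.+-identityʳ M) ⟩
          β σ * Ĝ.DelCon (suc M ℕ.+ spare) τ rest̂ + α σ * Ĝ.DelCon (M ℕ.+ spare) τ′ rest̂
            ≈⟨ +-cong (*-congˡ (≈-trans (continue (suc M) τ ρ matchesF (EnoughVertices-suc rest M ρ ok))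
                                        (G.DelCon-suc rest M ρ ok)))
                      (*-congˡ (continue M τ′ ρ (Matches-absorb dangling v<n h<F n≤F matchesF) ok)) ⟩
          β σ * (d * D) + α σ * D
            ≈⟨ solve 4 (λ b a d D → b :* (d :* D) :+ a :* D := (b :* d :+ a) :* D) ≈-refl (β σ) (α σ) d D ⟩
          X * D       ≈⟨ *-congʳ (*-identityʳ X) ⟨
          X ^ 1 * D   ∎
          where
          D = G.DelCon M ρ rest
          τ′ = identify τ h v
          g≡F : g ≡ F
          g≡F = trans (sym (ℕₚ.+-identityʳ g)) g+0≡F
          matchesF : Matches F τ ρ
          matchesF = subst (λ k → Matches k τ ρ) g≡F matches
          h<F : h < F
          h<F = subst (h <_) g≡F h<g
        pendantPath (suc j) {h} {g} {τ} {M} dangling h<g n≤g matches g+j≡F ok = begin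
          Ĝ.DelCon N τ ((h , g , σ) ∷ path)
            ≡⟨ Ĝ.edgeStep-link (α σ) (β σ) N τ path (Fresh⇒≢ (proj₂ matches) h<g) ⟩
          β σ * Ĝ.DelCon N τ path + α σ * Ĝ.DelCon (N ∸ 1) τ′ path
            ≡⟨ cong₂ (λ m m′ → β σ * Ĝ.DelCon m τ path + α σ * Ĝ.DelCon m′ τ′ path) count count′ ⟩
          β σ * Ĝ.DelCon (suc (suc M) ℕ.+ j ℕ.+ spare) τ path + α σ * Ĝ.DelCon (suc M ℕ.+ j ℕ.+ spare) τ′ path
            ≈⟨ +-cong (*-congˡ (≈-trans (pendantPath j (Fresh⇒Dangling (proj₂ matches) n≤g) (ℕₚ.n<1+n g) n≤g′
                                                      (proj₁ matches , Fresh-suc (proj₂ matches)) g+j≡F′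
                                                      (EnoughVertices-suc rest M ρ ok))
                                        (*-congˡ (G.DelCon-suc rest M ρ ok))))
                      (*-congˡ (pendantPath j (Dangling-extend dangling (proj₂ matches) n≤g) (ℕₚ.n<1+n g) n≤g′
                                            (Matches-extend h<g n≤g matches) g+j≡F′ ok)) ⟩
          β σ * (Xʲ * (d * D)) + α σ * (Xʲ * D)
            ≈⟨ solve 5 (λ b a d P D → b :* (P :* (d :* D)) :+ a :* (P :* D) := (b :* d :+ a) :* P :* D)
                     ≈-refl (β σ) (α σ) d Xʲ D ⟩
          X * Xʲ * D ∎
          where
          D = G.DelCon M ρ rest
          Xʲ = X ^ suc j
          N = suc M ℕ.+ suc j ℕ.+ spare
          path = chainE g v (suc g) σ (suc j) ++ rest̂
          τ′ = identify τ h g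
          count : N ≡ suc (suc M) ℕ.+ j ℕ.+ spare
          count = cong (λ m → suc m ℕ.+ spare) (ℕₚ.+-suc M j)
          count′ : N ∸ 1 ≡ suc M ℕ.+ j ℕ.+ spare
          count′ = cong (λ m → m ℕ.+ spare) (ℕₚ.+-suc M j)
          n≤g′ : n ≤ suc g
          n≤g′ = ℕₚ.m≤n⇒m≤1+n n≤g
          g+j≡F′ : suc g ℕ.+ j ≡ F
          g+j≡F′ = trans (sym (ℕₚ.+-suc g j)) g+j≡F

        chainDel-one : chainDel σ 1 ≈ β σ
        chainDel-one = ≈-trans (+-cong (*-identityʳ _) (zeroʳ _)) (+-identityʳ _)

        attachedPath : ∀ j {h g τ M col} → τ h ≡ τ u → h < g → n ≤ g → Matches g τ ρ → g ℕ.+ j ≡ F →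
                       EnoughVertices M ρ ((u , v , col) ∷ rest) →
                       Ĝ.DelCon (M ℕ.+ j ℕ.+ spare) τ (chainE h v g σ (suc j) ++ rest̂)
                       ≈ G.edgeStep (α σ ^ suc j) (chainDel σ (suc j)) M ρ u v rest
        attachedPath zero {h} {g} {τ} {M} {col} h~u h<g n≤g matches g+0≡F ok = begin
          Ĝ.DelCon (M ℕ.+ 0 ℕ.+ spare) τ ((h , v , σ) ∷ rest̂)
            ≡⟨ cong (λ m → Ĝ.DelCon (m ℕ.+ spare) τ ((h , v , σ) ∷ rest̂)) (ℕₚ.+-identityʳ M) ⟩
          Ĝ.DelCon (M ℕ.+ spare) τ ((h , v , σ) ∷ rest̂)
            ≈⟨ singleEdge {col = col} h~u
                          (subst (λ k → Matches k τ ρ) (trans (sym (ℕₚ.+-identityʳ g)) g+0≡F) matches) ok ⟩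
          G.edgeStep (α σ) (β σ) M ρ u v rest
            ≈⟨ G.edgeStep-cong M ρ u v rest (*-identityʳ _) chainDel-one ⟨
          G.edgeStep (α σ ^ 1) (chainDel σ 1) M ρ u v rest ∎
        attachedPath (suc j) {h} {g} {τ} {M} {col} h~u h<g n≤g matches g+j≡F ok = begin
          Ĝ.DelCon N τ ((h , g , σ) ∷ path)
            ≡⟨ Ĝ.edgeStep-link (α σ) (β σ) N τ path (Fresh⇒≢ (proj₂ matches) h<g) ⟩
          β σ * Ĝ.DelCon N τ path + α σ * Ĝ.DelCon (N ∸ 1) τ′ path
            ≡⟨ cong₂ (λ m m′ → β σ * Ĝ.DelCon m τ path + α σ * Ĝ.DelCon m′ τ′ path)
                     count (cong (_∸ 1) count) ⟩
          β σ * Ĝ.DelCon (suc M ℕ.+ j ℕ.+ spare) τ path + α σ * Ĝ.DelCon (M ℕ.+ j ℕ.+ spare) τ′ path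
            ≈⟨ +-cong (*-congˡ (pendantPath j (Fresh⇒Dangling (proj₂ matches) n≤g) (ℕₚ.n<1+n g) n≤g′
                                            (proj₁ matches , Fresh-suc (proj₂ matches)) g+j≡F′
                                            (EnoughVertices-tail (u , v , col) rest ok)))
                      (*-congˡ (attachedPath j {col = col} (attached-extend {τ = τ} h~u (proj₂ matches) u<n n≤g)
                                             (ℕₚ.n<1+n g) n≤g′
                                             (Matches-extend h<g n≤g matches) g+j≡F′ ok)) ⟩
          β σ * (X ^ suc j * G.DelCon M ρ rest) + α σ * G.edgeStep (α σ ^ suc j) (chainDel σ (suc j)) M ρ u v rest
            ≈⟨ G.edgeStep-prefix (β σ) (α σ) (X ^ suc j) _ _ M ρ u v rest ⟩
          G.edgeStep (α σ ^ suc (suc j)) (chainDel σ (suc (suc j))) M ρ u v rest ∎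
          where
          N = M ℕ.+ suc j ℕ.+ spare
          path = chainE g v (suc g) σ (suc j) ++ rest̂
          τ′ = identify τ h g
          count : N ≡ suc M ℕ.+ j ℕ.+ spare
          count = cong (ℕ._+ spare) (ℕₚ.+-suc M j)
          n≤g′ : n ≤ suc g
          n≤g′ = ℕₚ.m≤n⇒m≤1+n n≤g
          g+j≡F′ : suc g ℕ.+ j ≡ F
          g+j≡F′ = trans (sym (ℕₚ.+-suc g j)) g+j≡F

        loopSheaf : ∀ j N τ → τ u ≡ τ v →
                    Ĝ.DelCon N τ (replicate j (u , v , σ) ++ rest̂) ≈ Y ^ j * Ĝ.DelCon N τ rest̂
        loopSheaf zero    N τ _   = ≈-sym (*-identityˡ _)
        loopSheaf (suc j) N τ u~v = begin
          Ĝ.DelCon N τ ((u , v , σ) ∷ edges) ≡⟨ Ĝ.edgeStep-loop (α σ) (β σ) N τ edges u~v ⟩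
          Y * Ĝ.DelCon N τ edges              ≈⟨ *-congˡ (loopSheaf j N τ u~v) ⟩
          Y * (Y ^ j * Ĝ.DelCon N τ rest̂)     ≈⟨ *-assoc _ _ _ ⟨
          Y * Y ^ j * Ĝ.DelCon N τ rest̂       ∎
          where edges = replicate j (u , v , σ) ++ rest̂

        linkSheaf : ∀ j {τ M} → ¬ Same τ u v → Matches F τ ρ → EnoughVertices M ρ rest →
                    EnoughVertices (M ∸ 1) (identify ρ u v) rest →
                    Ĝ.DelCon (M ℕ.+ spare) τ (replicate j (u , v , σ) ++ rest̂)
                    ≈ β σ ^ j * G.DelCon M ρ rest + sheafCon σ j * G.DelCon (M ∸ 1) (identify ρ u v) rest
        linkSheaf zero {τ} {M} _ matches ok _ = begin
          Ĝ.DelCon (M ℕ.+ spare) τ rest̂ ≈⟨ continue M τ ρ matches ok ⟩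
          D                             ≈⟨ ≈-trans (+-cong (*-identityˡ D) (zeroˡ D′)) (+-identityʳ D) ⟨
          1# * D + 0# * D′              ∎
          where
          D = G.DelCon M ρ rest
          D′ = G.DelCon (M ∸ 1) (identify ρ u v) rest
        linkSheaf (suc j) {τ} {M} u≁v matches ok ok′ = begin
          Ĝ.DelCon N τ ((u , v , σ) ∷ edges) ≡⟨ Ĝ.edgeStep-link (α σ) (β σ) N τ edges u≁v ⟩
          β σ * Ĝ.DelCon N τ edges + α σ * Ĝ.DelCon (N ∸ 1) τ′ edges
            ≈⟨ +-cong (*-congˡ (linkSheaf j u≁v matches ok ok′))
                      (*-congˡ (loopSheaf j (N ∸ 1) τ′ (Same-identify⁺ τ u v (inj₂ (inj₁ refl , inj₂ refl))))) ⟩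
          β σ * (β σ ^ j * D + sheafCon σ j * D′) + α σ * (Y ^ j * Ĝ.DelCon (N ∸ 1) τ′ rest̂)
            ≈⟨ +-congˡ (*-congˡ (*-congˡ contracted)) ⟩
          β σ * (β σ ^ j * D + sheafCon σ j * D′) + α σ * (Y ^ j * D′)
            ≈⟨ solve 7 (λ b a B S P D D′ → b :* (B :* D :+ S :* D′) :+ a :* (P :* D′)
                                       := b :* B :* D :+ (b :* S :+ a :* P) :* D′)
                     ≈-refl (β σ) (α σ) (β σ ^ j) (sheafCon σ j) (Y ^ j) D D′ ⟩
          β σ * β σ ^ j * D + (β σ * sheafCon σ j + α σ * Y ^ j) * D′ ∎
          where
          N = M ℕ.+ spare
          edges = replicate j (u , v , σ) ++ rest̂
          τ′ = identify τ u v
          D = G.DelCon M ρ rest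
          D′ = G.DelCon (M ∸ 1) (identify ρ u v) rest
          contracted : Ĝ.DelCon (N ∸ 1) τ′ rest̂ ≈ D′
          contracted = ≈-trans (reflexive (cong (λ m → Ĝ.DelCon m τ′ rest̂)
                                                (ℕₚ.+-∸-comm spare (EnoughVertices-positive rest M ρ ok))))
                               (continue (M ∸ 1) τ′ (identify ρ u v) (Matches-identify matches u<n v<n n≤F) ok′)

        sheafBlock : ∀ j {τ M col} → Matches F τ ρ → EnoughVertices M ρ ((u , v , col) ∷ rest) →
                     Ĝ.DelCon (M ℕ.+ spare) τ (replicate j (u , v , σ) ++ rest̂)
                     ≈ G.edgeStep (sheafCon σ j) (β σ ^ j) M ρ u v rest
        sheafBlock j {τ} {M} matches ok with ρ u ℕ.≟ ρ v
        ... | yes u~v = begin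
          Ĝ.DelCon (M ℕ.+ spare) τ (replicate j (u , v , σ) ++ rest̂)
            ≈⟨ loopSheaf j _ τ (from (proj₁ matches) u<n v<n u~v) ⟩
          Y ^ j * Ĝ.DelCon (M ℕ.+ spare) τ rest̂
            ≈⟨ *-cong (≈-sym (sheafCon-spec σ j)) (continue M τ ρ matches ok) ⟩
          (sheafCon σ j * d + β σ ^ j) * G.DelCon M ρ rest ∎
        ... | no u≁v = linkSheaf j (λ u~v → u≁v (to (proj₁ matches) u<n v<n u~v)) matches (proj₁ ok) (proj₂ ok)

      newVertices : List (RawEdge × Repl) → ℕ
      newVertices []                   = 0
      newVertices ((_ , chain k) ∷ Ls) = k ∸ 1 ℕ.+ newVertices Ls
      newVertices ((_ , sheaf _) ∷ Ls) = newVertices Ls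

      hatE-vertices : ∀ f Ls → proj₁ (hatE f Ls) ≡ f ℕ.+ newVertices Ls
      hatE-vertices f []                   = sym (ℕₚ.+-identityʳ f)
      hatE-vertices f ((_ , chain k) ∷ Ls) = trans (hatE-vertices (f ℕ.+ (k ∸ 1)) Ls) (ℕₚ.+-assoc f (k ∸ 1) _)
      hatE-vertices f ((_ , sheaf _) ∷ Ls) = hatE-vertices f Ls

      colourEdge : RawEdge × Repl → ℕ × ℕ × Colour
      colourEdge ((u , v , σ) , r) = u , v , colour σ r

      Bounded : RawEdge → Set
      Bounded (u , v , _) = u < n × v < n

      Proper : RawEdge × Repl → Set
      Proper (e , r) = Bounded e × 1 ≤ size r

      hat-DelCon : ∀ Ls {f M ρ τ} → All Proper Ls → n ≤ f → Matches f τ ρ →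
                   EnoughVertices M ρ (map colourEdge Ls) →
                   Ĝ.DelCon (M ℕ.+ newVertices Ls) τ (proj₂ (hatE f Ls)) ≈ G.DelCon M ρ (map colourEdge Ls)
      hat-DelCon [] {M = M} [] _ _ _ = reflexive (cong (λ m → d ^ (m ∸ 1)) (ℕₚ.+-identityʳ M))
      hat-DelCon (((u , v , σ) , chain (suc j)) ∷ Ls) {f} {M} {ρ} {τ} (((u<n , v<n) , _) ∷ proper) n≤f matches ok =
        begin
        Ĝ.DelCon (M ℕ.+ (j ℕ.+ newVertices Ls)) τ path
          ≡⟨ cong (λ m → Ĝ.DelCon m τ path) (ℕₚ.+-assoc M j (newVertices Ls)) ⟨
        Ĝ.DelCon (M ℕ.+ j ℕ.+ newVertices Ls) τ path
          ≈⟨ Block.attachedPath σ u<n v<n ρ rest rest̂ (newVertices Ls) (f ℕ.+ j) n≤f+j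
                                (λ M′ τ′ ρ′ → hat-DelCon Ls proper n≤f+j)
                                j {col = colour σ (chain (suc j))} refl (ℕₚ.<-≤-trans u<n n≤f) n≤f matches refl ok ⟩
        G.edgeStep (α σ ^ suc j) (chainDel σ (suc j)) M ρ u v rest
          ≡⟨ cong₂ (λ p q → G.edgeStep p q M ρ u v rest) (byInt-signed _ σ j) (byInt-signed chainDel σ j) ⟨
        G.DelCon M ρ (map colourEdge (((u , v , σ) , chain (suc j)) ∷ Ls)) ∎
        where
        rest = map colourEdge Ls
        rest̂ = proj₂ (hatE (f ℕ.+ j) Ls)
        path = chainE u v f σ (suc j) ++ rest̂
        n≤f+j : n ≤ f ℕ.+ j
        n≤f+j = ℕₚ.≤-trans n≤f (ℕₚ.m≤m+n f j)
      hat-DelCon (((u , v , σ) , sheaf (suc j)) ∷ Ls) {f} {M} {ρ} {τ} (((u<n , v<n) , _) ∷ proper) n≤f matches ok =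
        begin
        Ĝ.DelCon (M ℕ.+ newVertices Ls) τ (replicate (suc j) (u , v , σ) ++ rest̂)
          ≈⟨ Block.sheafBlock σ u<n v<n ρ rest rest̂ (newVertices Ls) f n≤f
                              (λ M′ τ′ ρ′ → hat-DelCon Ls proper n≤f)
                              (suc j) {col = colour σ (sheaf (suc j))} matches ok ⟩
        G.edgeStep (sheafCon σ (suc j)) (β σ ^ suc j) M ρ u v rest
          ≡⟨ cong₂ (λ p q → G.edgeStep p q M ρ u v rest) (byInt-signed sheafCon σ j) (byInt-signed _ σ j) ⟨
        G.DelCon M ρ (map colourEdge (((u , v , σ) , sheaf (suc j)) ∷ Ls)) ∎
        where
        rest = map colourEdge Ls
        rest̂ = proj₂ (hatE f Ls)

  module Identity (A B d : Carrier) (cancel : ∀ u v → d * u ≈ d * v → u ≈ v) (x y : Colour → Carrier) where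
    open Replacement A B d

    Admissible : Colour → Set ℓ
    Admissible col = x col ≈ colourCon col × y col ≈ colourDel col

    chainDel-unique : ∀ σ k {w P} → P ≈ pendantFactor σ ^ k → d * w ≈ P − α σ ^ k → w ≈ chainDel σ k
    chainDel-unique σ k P≈ eq =
      cancel _ _ (≈-trans eq (≈-trans (+-congʳ P≈) (≈-sym (+⇒≈− (chainDel-spec σ k)))))

    sheafCon-unique : ∀ σ k {w P} → P ≈ loopFactor σ ^ k → d * w ≈ P − β σ ^ k → w ≈ sheafCon σ k
    sheafCon-unique σ k P≈ eq =
      cancel _ _ (≈-trans eq (≈-trans (+-congʳ P≈)
                                      (≈-sym (+⇒≈− (≈-trans (+-congʳ (*-comm d _)) (sheafCon-spec σ k))))))

    AdmissibleEdge : RawEdge × Repl → Set ℓ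
    AdmissibleEdge ((_ , _ , σ) , r) = Admissible (colour σ r)

    admissible⁺ : (∀ k → 1 ≤ k → x (c (+ k)) ≈ A ^ k) →
               (∀ k → 1 ≤ k → d * y (c (+ k)) ≈ (A + B * d) ^ k − A ^ k) →
               (∀ k → 1 ≤ k → d * x (s (+ k)) ≈ (A * d + B) ^ k − B ^ k) →
               (∀ k → 1 ≤ k → y (s (+ k)) ≈ B ^ k) →
               ∀ {e r} → proj₂ (proj₂ e) ≡ plus → 1 ≤ size r → AdmissibleEdge (e , r)
    admissible⁺ h₁ h₂ h₃ h₄ {_ , _ , .plus} {chain (suc j)} refl 1≤k =
      h₁ (suc j) 1≤k , chainDel-unique plus (suc j) (^-cong (suc j) (+-comm A (B * d))) (h₂ (suc j) 1≤k)
    admissible⁺ h₁ h₂ h₃ h₄ {_ , _ , .plus} {sheaf (suc j)} refl 1≤k =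
      sheafCon-unique plus (suc j) ≈-refl (h₃ (suc j) 1≤k) , h₄ (suc j) 1≤k

    admissible± : (∀ m → m ≢ 0ℤ → x (c m) ≈ zpow A B m) →
                  (∀ m → m ≢ 0ℤ → d * y (c m) ≈ zpow (A + B * d) (A * d + B) m − zpow A B m) →
                  (∀ m → m ≢ 0ℤ → d * x (s m) ≈ zpow (A * d + B) (A + B * d) m − zpow B A m) →
                  (∀ m → m ≢ 0ℤ → y (s m) ≈ zpow B A m) →
                  ∀ {e r} → 1 ≤ size r → AdmissibleEdge (e , r)
    admissible± g₁ g₂ g₃ g₄ {e@(_ , _ , plus)} {r} =
      admissible⁺ (λ k → g₁ (+ k) ∘ nonzero) (λ k → g₂ (+ k) ∘ nonzero)
                  (λ k → g₃ (+ k) ∘ nonzero) (λ k → g₄ (+ k) ∘ nonzero) {e} {r} refl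
      where
      nonzero : ∀ {k} → 1 ≤ k → + k ≢ 0ℤ
      nonzero (s≤s _) ()
    admissible± g₁ g₂ g₃ g₄ {_ , _ , minus} {chain (suc j)} _ =
      g₁ -[1+ j ] (λ ()) , chainDel-unique minus (suc j) ≈-refl (g₂ -[1+ j ] (λ ()))
    admissible± g₁ g₂ g₃ g₄ {_ , _ , minus} {sheaf (suc j)} _ =
      sheafCon-unique minus (suc j) (^-cong (suc j) (+-comm A (B * d))) (g₃ -[1+ j ] (λ ())) , g₄ -[1+ j ] (λ ())

    hatQ≈W : ∀ n → 1 ≤ n → (G : SignedGraph n) (ρs : List Repl) → All (λ r → 1 ≤ size r) ρs →
             All AdmissibleEdge (zip (forget G) ρs) → Qhat A B d n G ρs ≈ Wcol x y d d d G ρs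
    hatQ≈W n 1≤n G ρs sizes admissible = begin
      Qraw A B d (proj₁ hat) id (proj₂ hat)
        ≈⟨ Q≈DelCon (proj₁ hat) id (proj₂ hat) ⟩
      Ĝ.DelCon (proj₁ hat) id (proj₂ hat)
        ≡⟨ cong (λ m → Ĝ.DelCon m id (proj₂ hat)) (hatE-vertices n Ls) ⟩
      Ĝ.DelCon (n ℕ.+ newVertices Ls) id (proj₂ hat)
        ≈⟨ hat-DelCon Ls proper ℕₚ.≤-refl (≐-refl , λ _ _ _ a≡w → a≡w) ok ⟩
      G.DelCon n id (map colourEdge Ls)
        ≡⟨ cong (G.DelCon n id) coloured ⟩
      G.DelCon n id CL
        ≈⟨ DelCon-cong d n id CL weights ⟨
      DeletionContraction.DelCon x y d n id CL
        ≈⟨ SubsetExpansion.W≈DelCon x y d n CL (subst (EnoughVertices n id) coloured ok) ⟨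
      W x y d d d n CL ∎
      where
      open Replacing n
      Ls = zip (forget G) ρs
      hat = hatE n Ls
      CL = colouredGraph G ρs
      coloured : map colourEdge Ls ≡ CL
      coloured = Listₚ.map-cong (λ { ((_ , _ , _) , _) → refl }) Ls
      proper : All Proper Ls
      proper = All-zip {P = Bounded} {Q = λ r → 1 ≤ size r}
                       (Allₚ.map⁺ (All.universal (λ (u , v , _) → Finₚ.toℕ<n u , Finₚ.toℕ<n v) G)) sizes _,_
      ok : EnoughVertices n id (map colourEdge Ls)
      ok = Covers⇒EnoughVertices _ n id (upTo n) (subst (1 ≤_) (sym (Listₚ.length-upTo n)) 1≤n)
             (ℕₚ.≤-reflexive (Listₚ.length-upTo n))
             (Allₚ.map⁺ {P = EndsIn id (upTo n)} (All.map (λ {e} → ends {e}) proper))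
        where
        ends : ∀ {e} → Proper e → EndsIn id (upTo n) (colourEdge e)
        ends {(_ , _ , _) , _} ((u<n , v<n) , _) = ∈ₚ.∈-upTo⁺ u<n , ∈ₚ.∈-upTo⁺ v<n
      weights : All (Admissible ∘ label) CL
      weights = Allₚ.map⁺ admissible

theorem8 : ∀ {a ℓ} (R : CommutativeRing a ℓ) →
  let open CommutativeRing R
      open Poly R
  in
  -- Part 1: all lengths and widths positive; identity in ℤ[A,B,d]
  -- (expressed as: holds for all A, B, d in every commutative ring in
  -- which d is cancellable, the divisions by d being exact)
  ((A B d : Carrier) →
     (∀ u v → d * u ≈ d * v → u ≈ v) →
     let X = A + B * d
         Y = A * d + B
     in
     (x y : Colour → Carrier) →
     (∀ k → 1 ≤ k → x (c (+ k)) ≈ A ^ k) →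
     (∀ k → 1 ≤ k → d * y (c (+ k)) ≈ X ^ k − A ^ k) →
     (∀ k → 1 ≤ k → d * x (s (+ k)) ≈ Y ^ k − B ^ k) →
     (∀ k → 1 ≤ k → y (s (+ k)) ≈ B ^ k) →
     (n : ℕ) → 1 ≤ n → (G : SignedGraph n) →
     All (λ e → proj₂ (proj₂ e) ≡ plus) G →
     (ρ : List Repl) → length ρ ≡ length G → All (λ r → 1 ≤ size r) ρ →
     Qhat A B d n G ρ ≈ Wcol x y d d d G ρ)
  ×
  -- Part 2: arbitrary signs (lengths/widths arbitrary nonzero integers),
  -- after the substitution B = A⁻¹, d = -A² - A⁻²
  ((A B d : Carrier) →
     A * B ≈ 1# →
     d ≈ - (A * A) − B * B →
     (∀ u v → d * u ≈ d * v → u ≈ v) →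
     let X = A + B * d
         Y = A * d + B
     in
     (x y : Colour → Carrier) →
     (∀ m → m ≢ 0ℤ → x (c m) ≈ zpow A B m) →
     (∀ m → m ≢ 0ℤ → d * y (c m) ≈ zpow X Y m − zpow A B m) →
     (∀ m → m ≢ 0ℤ → d * x (s m) ≈ zpow Y X m − zpow B A m) →
     (∀ m → m ≢ 0ℤ → y (s m) ≈ zpow B A m) →
     (n : ℕ) → 1 ≤ n → (G : SignedGraph n) →
     (ρ : List Repl) → length ρ ≡ length G → All (λ r → 1 ≤ size r) ρ →
     Qhat A B d n G ρ ≈ Wcol x y d d d G ρ)
theorem8 R =
  (λ A B d cancel x y h₁ h₂ h₃ h₄ n 1≤n G positive-signs ρ _ sizes →
     let open Identity R A B d cancel x y in
     hatQ≈W n 1≤n G ρ sizes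
       (All-zip {P = λ e → proj₂ (proj₂ e) ≡ plus} (Allₚ.map⁺ positive-signs) sizes
                (λ {e} {r} → admissible⁺ h₁ h₂ h₃ h₄ {e} {r})))
  ,
  (λ A B d _ _ cancel x y g₁ g₂ g₃ g₄ n 1≤n G ρ _ sizes →
     let open Identity R A B d cancel x y in
     hatQ≈W n 1≤n G ρ sizes
       (All-zip {P = U} (All.universal _ (forget G)) sizes (λ {e} {r} _ → admissible± g₁ g₂ g₃ g₄ {e} {r})))
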